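{- Let $\mathscr{X}=(P,\Theta_P)$ be a div point set with $|P|=4$ that satisfies the three laws (L1), (L2), (L3) below. Then $\mathscr{X}$ is not isomorphic to $Conc_4^1$ if and only if $\mathscr{X}$ is isomorphic to $Conv_4$.
   Context: A div point set is an ordered pair $(P,\Theta_P)$ where $P$ is a nonempty finite set and $\Theta_P$ is a set with $|\Theta_P|=\binom{|P|}{2}$ such that: every $D\in\Theta_P$ is an ordered pair $D=(d,\delta)$ with $d\subseteq P$, $|d|=2$, and $\delta$ a set with exactly two elements (each a subset of $P$) satisfying $\bigcup\delta=P\setminus d$ and $\bigcap\delta=\varnothing$; and two elements of $\Theta_P$ are equal iff their first components are equal. We write $\pi_1(D)=d$, $\pi_2(D)=\delta$ (elements of $\Theta_P$ are called dividons). For a set $\delta$ of sets and a 2-element set $T\subseteq\bigcup\delta$, let $\phi(\delta,T)=1$ if some element of $\delta$ contains $T$, and $\phi(\delta,T)=0$ if every element of $\delta$ meets $T$ in at most one point. Laws (for every 4-element subset $R\subseteq P$ and all $D_1,D_2,D_3\in\Theta_P$, writing $\phi_i=\phi(\pi_2(D_i),R\setminus\pi_1(D_i))$): (L1) if $\pi_1(D_1)\cup\pi_1(D_2)\cup\pi_1(D_3)=R$ and $|\pi_1(D_1)\cap\pi_1(D_2)\cap\pi_1(D_3)|=1$, then ($\phi_1=0\iff\phi_2=\phi_3$); (L2) under the same hypothesis, ($\phi_1=1\iff\phi_2\neq\phi_3$); (L3) if $D_1,D_2,D_3$ are pairwise distinct, $\pi_1(D_1)\cup\pi_1(D_2)\cup\pi_1(D_3)\subset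 R$ and $|\pi_1(D_1)\cup\pi_1(D_2)\cup\pi_1(D_3)|=3$, then ($\phi_1=\phi_2=0\Rightarrow\phi_3=1$). Two div point sets $(A,\Theta_A)$, $(B,\Theta_B)$ are isomorphic if there is a bijection $f:A\to B$ such that for every $(d,\delta)\in\Theta_A$, the pair $(f[d],\{f[X]:X\in\delta\})$ belongs to $\Theta_B$ (here $f[X]$ is the image of the set $X$). $Conc_4^1=(\{1,2,3,4\},\Theta)$ with $\Theta=\{(\{1,2\},\{\{3\},\{4\}\}),(\{1,3\},\{\{2\},\{4\}\}),(\{1,4\},\{\{2\},\{3\}\}),(\{2,3\},\{\{1,4\},\varnothing\}),(\{2,4\},\{\{1,3\},\varnothing\}),(\{3,4\},\{\{1,2\},\varnothing\})\}$. $Conv_4=(\{1,2,3,4\},\Theta')$ with $\Theta'=\{(\{1,2\},\{\{3,4\},\varnothing\}),(\{1,3\},\{\{2\},\{4\}\}),(\{1,4\},\{\{2,3\},\varnothing\}),(\{2,3\},\{\{1,4\},\varnothing\}),(\{2,4\},\{\{1\},\{3\}\}),(\{3,4\},\{\{1,2\},\varnothing\})\}$. -}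

module Defs where

open import Data.Nat using (ℕ; _≤_)
open import Data.Nat.Combinatorics using (_C_)
open import Data.Bool using (Bool; true; false; _∧_; _∨_; not)
open import Data.Fin using (Fin; zero; suc)
open import Data.Fin.Properties using (_≟_)
open import Data.List using (List; []; _∷_; length)
open import Data.Bool.ListAction using (any)
open import Data.List.Membership.Propositional using (_∈_)
open import Data.List.Relation.Unary.Unique.Propositional using (Unique)
open import Data.List.Relation.Unary.AllPairs using (AllPairs)
open import Data.Product using (Σ; ∃; _×_; _,_)
open import Data.Sum using (_⊎_)
open import Relation.Binary.PropositionalEquality using (_≡_)
open import Relation.Nullary using (¬_)
open import Relation.Nullary.Decidable using (⌊_⌋)
open import Function.Bundles using (_↔_; _⇔_; Inverse)

Subset : Set → Set
Subset P = P → Bool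

_≐_ : {P : Set} → Subset P → Subset P → Set
S ≐ T = ∀ x → S x ≡ T x

_⊆_ : {P : Set} → Subset P → Subset P → Set
S ⊆ T = ∀ x → S x ≡ true → T x ≡ true

_⊂_ : {P : Set} → Subset P → Subset P → Set
S ⊂ T = S ⊆ T × ¬ (S ≐ T)

HasSize : {P : Set} → Subset P → ℕ → Set
HasSize {P} S k = Σ (List P) λ xs → Unique xs × length xs ≡ k × (∀ x → (S x ≡ true) ⇔ (x ∈ xs))

-- A dividon (d , δ) with δ = {δ₁ , δ₂} (an unordered pair of
-- distinct subsets) is stored as the triple (d , δ₁ , δ₂); the order of
-- δ₁, δ₂ is irrelevant (see _≈D_ and the isomorphism notion below).

record Dividon (P : Set) : Set where
  constructor div
  field
    dset : Subset P
    δ₁   : Subset P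
    δ₂   : Subset P
open Dividon public

record IsDividon {P : Set} (D : Dividon P) : Set where
  field
    two      : HasSize (dset D) 2
    distinct : ¬ (δ₁ D ≐ δ₂ D)
    union    : ∀ x → (δ₁ D x ∨ δ₂ D x) ≡ not (dset D x)
    disjoint : ∀ x → (δ₁ D x ∧ δ₂ D x) ≡ false

_≈D_ : {P : Set} → Dividon P → Dividon P → Set
D ≈D E = dset D ≐ dset E ×
         ((δ₁ D ≐ δ₁ E × δ₂ D ≐ δ₂ E) ⊎ (δ₁ D ≐ δ₂ E × δ₂ D ≐ δ₁ E))

-- The set Θ_P is represented by a list of dividons whose
-- first components are pairwise distinct (so the list has no repetitions
-- and two dividons are equal iff their first components are equal); its
-- length is then |Θ_P|.

record RawDPS : Set₁ where
  field
    P  : Set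
    Θ  : List (Dividon P)
open RawDPS public

record IsDivPointSet (X : RawDPS) : Set where
  field
    size      : ℕ
    enum      : P X ↔ Fin size
    nonempty  : 1 ≤ size
    dividons  : ∀ D → D ∈ Θ X → IsDividon D
    firstsDistinct : AllPairs (λ D E → ¬ (dset D ≐ dset E)) (Θ X)
    card      : length (Θ X) ≡ size C 2

-- The function φ, given relationally: Φ δ T b  means  φ(δ,T) = b.

Contains : {P : Set} → Subset P → Subset P → Set
Contains X T = T ⊆ X

MeetsAtMostOnce : {P : Set} → Subset P → Subset P → Set
MeetsAtMostOnce X T = ∀ x y → T x ≡ true → T y ≡ true → X x ≡ true → X y ≡ true → x ≡ y

Φ : {P : Set} → Dividon P → Subset P → Bool → Set
Φ D T true  = Contains (δ₁ D) T ⊎ Contains (δ₂ D) T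
Φ D T false = MeetsAtMostOnce (δ₁ D) T × MeetsAtMostOnce (δ₂ D) T

_∖_ : {P : Set} → Subset P → Dividon P → Subset P
(R ∖ D) x = R x ∧ not (dset D x)

φ≡ : {P : Set} → Subset P → Dividon P → Bool → Set
φ≡ R D b = Φ D (R ∖ D) b

union3 : {P : Set} → Dividon P → Dividon P → Dividon P → Subset P
union3 D₁ D₂ D₃ x = dset D₁ x ∨ dset D₂ x ∨ dset D₃ x

inter3 : {P : Set} → Dividon P → Dividon P → Dividon P → Subset P
inter3 D₁ D₂ D₃ x = dset D₁ x ∧ dset D₂ x ∧ dset D₃ x

L12-hyp : {P : Set} → Subset P → Dividon P → Dividon P → Dividon P → Set
L12-hyp R D₁ D₂ D₃ = union3 D₁ D₂ D₃ ≐ R × HasSize (inter3 D₁ D₂ D₃) 1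

Law1 : RawDPS → Set
Law1 X = ∀ (R : Subset (P X)) → HasSize R 4 →
  ∀ D₁ D₂ D₃ → D₁ ∈ Θ X → D₂ ∈ Θ X → D₃ ∈ Θ X → L12-hyp R D₁ D₂ D₃ →
  φ≡ R D₁ false ⇔ (∃ λ b → φ≡ R D₂ b × φ≡ R D₃ b)

Law2 : RawDPS → Set
Law2 X = ∀ (R : Subset (P X)) → HasSize R 4 →
  ∀ D₁ D₂ D₃ → D₁ ∈ Θ X → D₂ ∈ Θ X → D₃ ∈ Θ X → L12-hyp R D₁ D₂ D₃ →
  φ≡ R D₁ true ⇔ (∃ λ b → φ≡ R D₂ b × φ≡ R D₃ (not b))

Law3 : RawDPS → Set
Law3 X = ∀ (R : Subset (P X)) → HasSize R 4 →
  ∀ D₁ D₂ D₃ → D₁ ∈ Θ X → D₂ ∈ Θ X → D₃ ∈ Θ X →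
  ¬ (D₁ ≈D D₂) → ¬ (D₁ ≈D D₃) → ¬ (D₂ ≈D D₃) →
  union3 D₁ D₂ D₃ ⊂ R → HasSize (union3 D₁ D₂ D₃) 3 →
  φ≡ R D₁ false → φ≡ R D₂ false → φ≡ R D₃ true

image : {A B : Set} → A ↔ B → Subset A → Subset B
image f X y = X (Inverse.from f y)

mapDividon : {A B : Set} → A ↔ B → Dividon A → Dividon B
mapDividon f D = div (image f (dset D)) (image f (δ₁ D)) (image f (δ₂ D))

_∈Θ_ : {A : Set} → Dividon A → List (Dividon A) → Set
D ∈Θ Θs = ∃ λ E → E ∈ Θs × (D ≈D E)

Isomorphic : RawDPS → RawDPS → Set
Isomorphic X Y = Σ (P X ↔ P Y) λ f → ∀ D → D ∈ Θ X → mapDividon f D ∈Θ Θ Y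

-- Conc₄¹ and Conv₄ on {1,2,3,4}, encoded as Fin 4 with i ↦ i - 1.

⟦_⟧ : List (Fin 4) → Subset (Fin 4)
⟦ xs ⟧ x = any (λ y → ⌊ x ≟ y ⌋) xs

p1 p2 p3 p4 : Fin 4
p1 = zero
p2 = suc zero
p3 = suc (suc zero)
p4 = suc (suc (suc zero))

Conc41 : RawDPS
Conc41 = record
  { P = Fin 4
  ; Θ = div ⟦ p1 ∷ p2 ∷ [] ⟧ ⟦ p3 ∷ [] ⟧ ⟦ p4 ∷ [] ⟧
      ∷ div ⟦ p1 ∷ p3 ∷ [] ⟧ ⟦ p2 ∷ [] ⟧ ⟦ p4 ∷ [] ⟧
      ∷ div ⟦ p1 ∷ p4 ∷ [] ⟧ ⟦ p2 ∷ [] ⟧ ⟦ p3 ∷ [] ⟧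
      ∷ div ⟦ p2 ∷ p3 ∷ [] ⟧ ⟦ p1 ∷ p4 ∷ [] ⟧ ⟦ [] ⟧
      ∷ div ⟦ p2 ∷ p4 ∷ [] ⟧ ⟦ p1 ∷ p3 ∷ [] ⟧ ⟦ [] ⟧
      ∷ div ⟦ p3 ∷ p4 ∷ [] ⟧ ⟦ p1 ∷ p2 ∷ [] ⟧ ⟦ [] ⟧
      ∷ []
  }

Conv4 : RawDPS
Conv4 = record
  { P = Fin 4
  ; Θ = div ⟦ p1 ∷ p2 ∷ [] ⟧ ⟦ p3 ∷ p4 ∷ [] ⟧ ⟦ [] ⟧
      ∷ div ⟦ p1 ∷ p3 ∷ [] ⟧ ⟦ p2 ∷ [] ⟧ ⟦ p4 ∷ [] ⟧
      ∷ div ⟦ p1 ∷ p4 ∷ [] ⟧ ⟦ p2 ∷ p3 ∷ [] ⟧ ⟦ [] ⟧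
      ∷ div ⟦ p2 ∷ p3 ∷ [] ⟧ ⟦ p1 ∷ p4 ∷ [] ⟧ ⟦ [] ⟧
      ∷ div ⟦ p2 ∷ p4 ∷ [] ⟧ ⟦ p1 ∷ [] ⟧ ⟦ p3 ∷ [] ⟧
      ∷ div ⟦ p3 ∷ p4 ∷ [] ⟧ ⟦ p1 ∷ p2 ∷ [] ⟧ ⟦ [] ⟧
      ∷ []
  }

module Submission where

-- Fix coordinates e : P ↔ Fin 4.  Each dividon of X has a 2-element first
-- component, i.e. an edge k of the complete graph K₄ (six edges, `Edge`),
-- and its second component splits the two remaining points a, b of k's
-- complement either together ({a,b},∅) or apart ({a},{b}).  Such a dividon is
-- determined up to ≈D by k and by the bit φ(π₂ D, {a,b}) (`determined`).
-- Since |Θ| = 6 and first components are distinct, every edge carries exactly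
-- one dividon, so X is isomorphic, in both directions, to the canonical
-- structure `Canon β` given by its profile β : Edge → Bool.
--
-- With R = P, laws (L1)+(L2) at the star of a vertex force the parity relation
-- φ₁ = φ₂ xor φ₃, and (L3) forbids a triangle of three split dividons.  A finite
-- check shows that the only such profiles are the four "star" profiles (split
-- exactly on the edges through one vertex) and the three "matching" profiles
-- (split exactly on a perfect matching).  Star profiles are isomorphic to
-- Conc₄¹ and not to Conv₄, matching profiles conversely, again by finite
-- checks; the theorem follows by transitivity of isomorphism.

open import Defs
open import Data.Nat as ℕ using (ℕ)
open import Data.Bool using (Bool; true; false; not; _∧_; _∨_; _xor_; if_then_else_)
import Data.Bool.Properties as Bool
open import Data.Fin using (Fin; zero; suc; #_; _<_; punchIn; punchOut)
open import Data.Fin.Properties using (_≟_; all?; any?; pigeonhole; punchIn-injective; punchOut-injective)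
open import Data.Fin.Permutation using (transpose)
open import Data.List using (List; []; _∷_; length; map; allFin)
import Data.List as List
open import Data.List.Properties using (length-map)
open import Data.Nat.Properties using (n<1+n)
open import Data.Nat.Combinatorics using (_C_)
import Data.List.Relation.Unary.All as All
import Data.List.Relation.Unary.Any as Any
open import Data.List.Relation.Unary.Any using (here; there)
open import Data.List.Relation.Unary.AllPairs using (AllPairs; []; _∷_)
import Data.List.Relation.Unary.AllPairs.Properties as AllPairs
open import Data.List.Relation.Unary.Unique.Propositional using (Unique)
import Data.List.Relation.Unary.Unique.Propositional.Properties as Unique
open import Data.List.Membership.Propositional using (_∈_; find; lose)
open import Data.List.Membership.Propositional.Properties using (∈-map⁺; ∈-map⁻; ∈-allFin; ∈-lookup)
open import Data.Vec using (Vec; _∷_; []; lookup; tabulate)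
open import Data.Vec.Properties using (lookup∘tabulate)
open import Data.Product using (∃; _×_; _,_; proj₁; proj₂)
open import Data.Sum using (_⊎_; inj₁; inj₂) renaming (map to map-⊎)
open import Data.Empty using (⊥; ⊥-elim)
open import Function using (_∘_; id)
open import Function.Bundles using (_↔_; _⇔_; Inverse; Equivalence; mk⇔)
open import Function.Construct.Composition using (_↔-∘_)
open import Function.Construct.Identity using (↔-id)
open import Function.Construct.Symmetry using (↔-sym)
open import Relation.Binary.PropositionalEquality using (_≡_; _≢_; refl; sym; trans; cong; cong₂; subst; subst₂)
open import Relation.Nullary using (Dec; yes; no; ¬_; ¬?; contradiction)
open import Relation.Nullary.Decidable using (_×-dec_; _⊎-dec_; _→-dec_; map′; from-yes)
open import Relation.Unary using (Decidable)

≐-sym : {A : Set} {S T : Subset A} → S ≐ T → T ≐ S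
≐-sym S≐T x = sym (S≐T x)

≐-trans : {A : Set} {S T U : Subset A} → S ≐ T → T ≐ U → S ≐ U
≐-trans S≐T T≐U x = trans (S≐T x) (T≐U x)

true≢false : true ≢ false
true≢false ()

⇔-true : {a b : Bool} → (a ≡ true ⇔ b ≡ true) → a ≡ b
⇔-true {true}          a⇔b = sym (Equivalence.to a⇔b refl)
⇔-true {false} {false} a⇔b = refl
⇔-true {false} {true}  a⇔b = Equivalence.from a⇔b refl

⟦⟧-sound : (xs : List (Fin 4)) {x : Fin 4} → ⟦ xs ⟧ x ≡ true → x ∈ xs
⟦⟧-sound (y ∷ ys) {x} h with x ≟ y
... | yes x≡y = here x≡y
... | no _    = there (⟦⟧-sound ys h)

⟦⟧-complete : {xs : List (Fin 4)} {x : Fin 4} → x ∈ xs → ⟦ xs ⟧ x ≡ true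
⟦⟧-complete {y ∷ ys} {x} x∈ with x ≟ y | x∈
... | yes _   | _          = refl
... | no x≢y  | here x≡y   = contradiction x≡y x≢y
... | no _    | there x∈ys = ⟦⟧-complete x∈ys

HasSize-⟦⟧ : (xs : List (Fin 4)) → Unique xs → HasSize ⟦ xs ⟧ (length xs)
HasSize-⟦⟧ xs unique = xs , unique , refl , λ x → mk⇔ (⟦⟧-sound xs) ⟦⟧-complete

enumerated : {S : Subset (Fin 4)} {xs : List (Fin 4)} →
             (∀ x → (S x ≡ true) ⇔ (x ∈ xs)) → S ≐ ⟦ xs ⟧
enumerated {xs = xs} S⇔xs x =
  ⇔-true (mk⇔ (⟦⟧-complete ∘ Equivalence.to (S⇔xs x)) (Equivalence.from (S⇔xs x) ∘ ⟦⟧-sound xs))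

HasSize-≐ : {A : Set} {S T : Subset A} {n : ℕ} → S ≐ T → HasSize S n → HasSize T n
HasSize-≐ S≐T (xs , unique , len , S⇔xs) =
  xs , unique , len , λ x → mk⇔ (Equivalence.to (S⇔xs x) ∘ trans (S≐T x))
                               (trans (sym (S≐T x)) ∘ Equivalence.from (S⇔xs x))

HasSize-pull : {A B : Set} (f : A ↔ B) {T : Subset B} {n : ℕ} →
               HasSize T n → HasSize (λ x → T (Inverse.to f x)) n
HasSize-pull f {T} (xs , unique , len , T⇔xs) =
  map from xs , Unique.map⁺ from-injective unique , trans (length-map from xs) len ,
  λ x → mk⇔ (λ Tx → subst (_∈ map from xs) (Inverse.strictlyInverseʳ f x)
                          (∈-map⁺ from (Equivalence.to (T⇔xs (to x)) Tx)))
            (λ x∈ → let (y , y∈xs , x≡y) = ∈-map⁻ from x∈ in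
                    Equivalence.from (T⇔xs (to x))
                      (subst (_∈ xs) (sym (trans (cong to x≡y) (Inverse.strictlyInverseˡ f y))) y∈xs))
  where
    open Inverse f using (to; from)
    from-injective : ∀ {y z} → from y ≡ from z → y ≡ z
    from-injective {y} {z} eq =
      trans (sym (Inverse.strictlyInverseˡ f y)) (trans (cong to eq) (Inverse.strictlyInverseˡ f z))

lookup-distinct : {A : Set} {zs : List A} → Unique zs → ∀ {i j} → i < j →
                  List.lookup zs i ≢ List.lookup zs j
lookup-distinct (z∉ ∷ _)      {zero}  {suc j} _              = All.lookup z∉ (∈-lookup j)
lookup-distinct (_ ∷ unique) {suc i} {suc j} (ℕ.s≤s i<j) = lookup-distinct unique i<j

unique-covers : ∀ {n} (ys : List (Fin n)) → Unique ys → length ys ≡ n → ∀ c → c ∈ ys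
unique-covers {ℕ.suc m} ys unique len c with Any.any? (c ≟_) ys
... | yes c∈ys = c∈ys
... | no  c∉ys = ⊥-elim (collision (pigeonhole m<len squeeze))
  where
    avoids : ∀ i → c ≢ List.lookup ys i
    avoids i c≡ = c∉ys (subst (_∈ ys) (sym c≡) (∈-lookup i))
    -- ys lives in Fin (suc m) ∖ {c}, which has only m elements
    squeeze : Fin (length ys) → Fin m
    squeeze i = punchOut (avoids i)
    m<len : m ℕ.< length ys
    m<len = subst (m ℕ.<_) (sym len) (n<1+n m)
    collision : (∃ λ i → ∃ λ j → i < j × squeeze i ≡ squeeze j) → ⊥
    collision (i , j , i<j , same) =
      lookup-distinct unique i<j (punchOut-injective (avoids i) (avoids j) same)

AllPairs-weaken : {A : Set} {R S : A → A → Set} {xs : List A} →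
                  (∀ {x y} → x ∈ xs → y ∈ xs → R x y → S x y) → AllPairs R xs → AllPairs S xs
AllPairs-weaken R⇒S []          = []
AllPairs-weaken R⇒S (Rx ∷ Rxs) =
  All.tabulate (λ y∈ → R⇒S (here refl) (there y∈) (All.lookup Rx y∈)) ∷
  AllPairs-weaken (λ x∈ y∈ → R⇒S (there x∈) (there y∈)) Rxs

AllPairs-same : {A : Set} {R : A → A → Set} {xs : List A} → AllPairs R xs →
                ∀ {x y} → x ∈ xs → y ∈ xs → ¬ R x y → ¬ R y x → x ≡ y
AllPairs-same (_ ∷ _)    (here refl) (here refl) _     _     = refl
AllPairs-same (Rx ∷ _)   (here refl) (there y∈)  ¬Rxy  _     = ⊥-elim (¬Rxy (All.lookup Rx y∈))
AllPairs-same (Ry ∷ _)   (there x∈)  (here refl) _     ¬Ryx  = ⊥-elim (¬Ryx (All.lookup Ry x∈))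
AllPairs-same (_ ∷ Rxs) (there x∈)  (there y∈)  ¬Rxy  ¬Ryx  = AllPairs-same Rxs x∈ y∈ ¬Rxy ¬Ryx

-- Relabelling of a dividon along a map of points; `mapDividon f` is
-- definitionally `pull (Inverse.from f)`.
pull : {A B : Set} → (B → A) → Dividon A → Dividon B
pull g D = div (dset D ∘ g) (δ₁ D ∘ g) (δ₂ D ∘ g)

≈D-refl : {A : Set} {D : Dividon A} → D ≈D D
≈D-refl = (λ _ → refl) , inj₁ ((λ _ → refl) , (λ _ → refl))

≈D-trans : {A : Set} {D E F : Dividon A} → D ≈D E → E ≈D F → D ≈D F
≈D-trans (d , inj₁ (p , q)) (d′ , inj₁ (p′ , q′)) = ≐-trans d d′ , inj₁ (≐-trans p p′ , ≐-trans q q′)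
≈D-trans (d , inj₁ (p , q)) (d′ , inj₂ (p′ , q′)) = ≐-trans d d′ , inj₂ (≐-trans p p′ , ≐-trans q q′)
≈D-trans (d , inj₂ (p , q)) (d′ , inj₁ (p′ , q′)) = ≐-trans d d′ , inj₂ (≐-trans p q′ , ≐-trans q p′)
≈D-trans (d , inj₂ (p , q)) (d′ , inj₂ (p′ , q′)) = ≐-trans d d′ , inj₁ (≐-trans p q′ , ≐-trans q p′)

∈Θ-resp : {A : Set} {D E : Dividon A} {Es : List (Dividon A)} → D ≈D E → E ∈Θ Es → D ∈Θ Es
∈Θ-resp D≈E (F , F∈ , E≈F) = F , F∈ , ≈D-trans D≈E E≈F

pull-resp : {A B : Set} (g : B → A) {D E : Dividon A} → D ≈D E → pull g D ≈D pull g E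
pull-resp g (d , inj₁ (p , q)) = d ∘ g , inj₁ (p ∘ g , q ∘ g)
pull-resp g (d , inj₂ (p , q)) = d ∘ g , inj₂ (p ∘ g , q ∘ g)

pull-cong : {A B : Set} {g h : B → A} → (∀ y → g y ≡ h y) → (D : Dividon A) → pull g D ≈D pull h D
pull-cong g≗h D = cong (dset D) ∘ g≗h , inj₁ (cong (δ₁ D) ∘ g≗h , cong (δ₂ D) ∘ g≗h)

Isomorphic-trans : {X Y Z : RawDPS} → Isomorphic X Y → Isomorphic Y Z → Isomorphic X Z
Isomorphic-trans {X} {Y} {Z} (f , f-maps) (g , g-maps) = g ↔-∘ f , composite-maps
  where
    composite-maps : ∀ D → D ∈ Θ X → mapDividon (g ↔-∘ f) D ∈Θ Θ Z
    composite-maps D D∈ =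
      let (E , E∈ , fD≈E) = f-maps D D∈ in
      ∈Θ-resp (pull-resp (Inverse.from g) fD≈E) (g-maps E E∈)

-- φ and dividons whose complement has two points

Φ-functional : {A : Set} (D : Dividon A) (T : Subset A) {x y : A} → x ≢ y →
               T x ≡ true → T y ≡ true → ∀ {b c} → Φ D T b → Φ D T c → b ≡ c
Φ-functional D T x≢y Tx Ty {true}  {true}  _ _ = refl
Φ-functional D T x≢y Tx Ty {false} {false} _ _ = refl
Φ-functional D T {x} {y} x≢y Tx Ty {true}  {false} inside split = ⊥-elim (x≢y (together-apart inside split))
  where
    together-apart : Φ D T true → Φ D T false → x ≡ y
    together-apart (inj₁ T⊆δ₁) (once₁ , _) = once₁ _ _ Tx Ty (T⊆δ₁ _ Tx) (T⊆δ₁ _ Ty)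
    together-apart (inj₂ T⊆δ₂) (_ , once₂) = once₂ _ _ Tx Ty (T⊆δ₂ _ Tx) (T⊆δ₂ _ Ty)
Φ-functional D T x≢y Tx Ty {false} {true}  split inside =
  sym (Φ-functional D T x≢y Tx Ty inside split)

-- The whole point set, the only 4-element R when |P| = 4.
full : {A : Set} → Subset A
full _ = true

record OnPair {A : Set} (D : Dividon A) (a b : A) : Set where
  field
    cover    : ∀ x → (δ₁ D x ∨ δ₂ D x) ≡ not (dset D x)
    disjoint : ∀ x → (δ₁ D x ∧ δ₂ D x) ≡ false
    a≢b      : a ≢ b
    a∉       : dset D a ≡ false
    b∉       : dset D b ≡ false
    outside  : ∀ x → dset D x ≡ false → x ≡ a ⊎ x ≡ b

-- φ(π₂ D, {a,b}) as a Boolean: true iff δ₁ does not separate a and b.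
phi : {A : Set} → Dividon A → A → A → Bool
phi D a b = not (δ₁ D a xor δ₁ D b)

module _ {A : Set} {D : Dividon A} {a b : A} (onPair : OnPair D a b) where
  open OnPair onPair

  δ₁-inside : ∀ {x} → dset D x ≡ true → δ₁ D x ≡ false
  δ₁-inside {x} x∈ = Bool.∨-conicalˡ _ _ (trans (cover x) (cong not x∈))

  δ₂-inside : ∀ {x} → dset D x ≡ true → δ₂ D x ≡ false
  δ₂-inside {x} x∈ = Bool.∨-conicalʳ _ _ (trans (cover x) (cong not x∈))

  δ₂-outside : ∀ {x} → dset D x ≡ false → δ₂ D x ≡ not (δ₁ D x)
  δ₂-outside {x} x∉ = complementary (trans (cover x) (cong not x∉)) (disjoint x)
    where
      complementary : ∀ {p q} → (p ∨ q) ≡ true → (p ∧ q) ≡ false → q ≡ not p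
      complementary {true}  {false} _ _ = refl
      complementary {false} {true}  _ _ = refl

  in-complement : ∀ {x} → (full ∖ D) x ≡ true → x ≡ a ⊎ x ≡ b
  in-complement {x} x∈ = outside x (Bool.not-injective x∈)

  agree : (S U : Subset A) → (∀ x → dset D x ≡ true → S x ≡ U x) → S a ≡ U a → S b ≡ U b → S ≐ U
  agree S U inside Sa Sb x with dset D x in x∈
  ... | true  = inside x x∈
  ... | false with outside x x∈
  ... | inj₁ refl = Sa
  ... | inj₂ refl = Sb

  constant : (S : Subset A) {c : Bool} → S a ≡ c → S b ≡ c → ∀ x → (full ∖ D) x ≡ true → S x ≡ c
  constant S Sa Sb x x∈ with in-complement x∈
  ... | inj₁ refl = Sa
  ... | inj₂ refl = Sb

  separating : (S : Subset A) → S a ≢ S b → MeetsAtMostOnce S (full ∖ D)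
  separating S Sa≢Sb x y x∈ y∈ Sx Sy with in-complement x∈ | in-complement y∈
  ... | inj₁ refl | inj₁ refl = refl
  ... | inj₂ refl | inj₂ refl = refl
  ... | inj₁ refl | inj₂ refl = ⊥-elim (Sa≢Sb (trans Sx (sym Sy)))
  ... | inj₂ refl | inj₁ refl = ⊥-elim (Sa≢Sb (trans Sy (sym Sx)))

  Φ-split : δ₁ D a ≢ δ₁ D b → φ≡ full D false
  Φ-split δ₁-apart = separating (δ₁ D) δ₁-apart , separating (δ₂ D) (δ₁-apart ∘ δ₂→δ₁)
    where
      δ₂→δ₁ : δ₂ D a ≡ δ₂ D b → δ₁ D a ≡ δ₁ D b
      δ₂→δ₁ eq = Bool.not-injective (trans (sym (δ₂-outside a∉)) (trans eq (δ₂-outside b∉)))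

  Φ-phi : φ≡ full D (phi D a b)
  Φ-phi with δ₁ D a in δ₁a | δ₁ D b in δ₁b
  ... | true  | true  = inj₁ (constant (δ₁ D) δ₁a δ₁b)
  ... | false | false = inj₂ (constant (δ₂ D) (δ₂-true δ₁a a∉) (δ₂-true δ₁b b∉))
    where
      δ₂-true : ∀ {x} → δ₁ D x ≡ false → dset D x ≡ false → δ₂ D x ≡ true
      δ₂-true δ₁x x∉ = trans (δ₂-outside x∉) (cong not δ₁x)
  ... | true  | false = Φ-split (λ eq → true≢false (trans (sym δ₁a) (trans eq δ₁b)))
  ... | false | true  = Φ-split (λ eq → true≢false (trans (sym δ₁b) (trans (sym eq) δ₁a)))

  Φ-determines : ∀ {c} → φ≡ full D c → c ≡ phi D a b
  Φ-determines Φc = Φ-functional D (full ∖ D) a≢b (cong not a∉) (cong not b∉) Φc Φ-phi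

xor-same : ∀ x {y y′} → x xor y ≡ x xor y′ → y ≡ y′
xor-same true  eq = Bool.not-injective eq
xor-same false eq = eq

xor-flip : ∀ x {y y′} → x xor y ≡ not x xor y′ → y ≡ not y′
xor-flip true  eq = trans (sym (Bool.not-involutive _)) (cong not eq)
xor-flip false eq = eq

module _ {A : Set} {D E : Dividon A} {a b : A} (onD : OnPair D a b) (onE : OnPair E a b)
         (same-dset : dset D ≐ dset E) where
  private
    E-inside : ∀ {x} → dset D x ≡ true → dset E x ≡ true
    E-inside {x} x∈ = trans (sym (same-dset x)) x∈

    E-outside : ∀ {x} → dset D x ≡ false → dset E x ≡ false
    E-outside {x} x∉ = trans (sym (same-dset x)) x∉

    vanish : (S U : Subset A) → (∀ {x} → dset D x ≡ true → S x ≡ false) →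
             (∀ {x} → dset E x ≡ true → U x ≡ false) → ∀ x → dset D x ≡ true → S x ≡ U x
    vanish S U S-empty U-empty x x∈ = trans (S-empty x∈) (sym (U-empty (E-inside x∈)))

    δ₂D-outside : ∀ {x} → dset D x ≡ false → δ₂ D x ≡ not (δ₁ D x)
    δ₂D-outside = δ₂-outside onD

    δ₂E-outside : ∀ {x} → dset D x ≡ false → δ₂ E x ≡ not (δ₁ E x)
    δ₂E-outside x∉ = δ₂-outside onE (E-outside x∉)

    open OnPair onD using (a∉; b∉)

  determined : phi D a b ≡ phi E a b → D ≈D E
  determined phi≡ with δ₁ D a Bool.≟ δ₁ E a
  ... | yes a-same =
    same-dset , inj₁ ( agree onD (δ₁ D) (δ₁ E) (vanish _ _ (δ₁-inside onD) (δ₁-inside onE)) a-same b-same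
                     , agree onD (δ₂ D) (δ₂ E) (vanish _ _ (δ₂-inside onD) (δ₂-inside onE))
                             (δ₂-same a∉ a-same) (δ₂-same b∉ b-same))
    where
      b-same : δ₁ D b ≡ δ₁ E b
      b-same = xor-same (δ₁ D a) (trans (Bool.not-injective phi≡) (cong (_xor δ₁ E b) (sym a-same)))
      δ₂-same : ∀ {x} → dset D x ≡ false → δ₁ D x ≡ δ₁ E x → δ₂ D x ≡ δ₂ E x
      δ₂-same x∉ eq = trans (δ₂D-outside x∉) (trans (cong not eq) (sym (δ₂E-outside x∉)))
  ... | no a-differ =
    same-dset , inj₂ ( agree onD (δ₁ D) (δ₂ E) (vanish _ _ (δ₁-inside onD) (δ₂-inside onE))
                             (δ₁-swap a∉ a-flip) (δ₁-swap b∉ b-flip)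
                     , agree onD (δ₂ D) (δ₁ E) (vanish _ _ (δ₂-inside onD) (δ₁-inside onE))
                             (δ₂-swap a∉ a-flip) (δ₂-swap b∉ b-flip))
    where
      a-flip : δ₁ D a ≡ not (δ₁ E a)
      a-flip = Bool.¬-not a-differ
      b-flip : δ₁ D b ≡ not (δ₁ E b)
      b-flip = xor-flip (δ₁ D a) (trans (Bool.not-injective phi≡)
                                        (cong (_xor δ₁ E b) (Bool.¬-not (a-differ ∘ sym))))
      δ₁-swap : ∀ {x} → dset D x ≡ false → δ₁ D x ≡ not (δ₁ E x) → δ₁ D x ≡ δ₂ E x
      δ₁-swap x∉ eq = trans eq (sym (δ₂E-outside x∉))
      δ₂-swap : ∀ {x} → dset D x ≡ false → δ₁ D x ≡ not (δ₁ E x) → δ₂ D x ≡ δ₁ E x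
      δ₂-swap x∉ eq = trans (δ₂D-outside x∉) (trans (cong not eq) (Bool.not-involutive _))

OnPair-map : {A B : Set} (f : A ↔ B) {D : Dividon A} {a b : A} →
             OnPair D a b → OnPair (mapDividon f D) (Inverse.to f a) (Inverse.to f b)
OnPair-map f {D} onD = record
  { cover    = cover ∘ from
  ; disjoint = disjoint ∘ from
  ; a≢b      = λ eq → a≢b (trans (sym (from∘to _)) (trans (cong from eq) (from∘to _)))
  ; a∉       = trans (cong (dset D) (from∘to _)) a∉
  ; b∉       = trans (cong (dset D) (from∘to _)) b∉
  ; outside  = λ y y∉ → map-⊎ (back y) (back y) (outside (from y) y∉)
  }
  where
    open OnPair onD
    open Inverse f using (to; from)
    from∘to : ∀ x → from (to x) ≡ x
    from∘to = Inverse.strictlyInverseʳ f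
    back : ∀ y {x} → from y ≡ x → y ≡ to x
    back y eq = trans (sym (Inverse.strictlyInverseˡ f y)) (cong to eq)

law-xor : {Φ₁ Φ₂ Φ₃ : Bool → Set} →
          (Φ₁ false ⇔ (∃ λ b → Φ₂ b × Φ₃ b)) → (Φ₁ true ⇔ (∃ λ b → Φ₂ b × Φ₃ (not b))) →
          ∀ {b₂ b₃} → Φ₂ b₂ → Φ₃ b₃ → Φ₁ (b₂ xor b₃)
law-xor l1 l2 {false} {false} Φ₂b Φ₃b = Equivalence.from l1 (false , Φ₂b , Φ₃b)
law-xor l1 l2 {true}  {true}  Φ₂b Φ₃b = Equivalence.from l1 (true , Φ₂b , Φ₃b)
law-xor l1 l2 {true}  {false} Φ₂b Φ₃b = Equivalence.from l2 (true , Φ₂b , Φ₃b)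
law-xor l1 l2 {false} {true}  Φ₂b Φ₃b = Equivalence.from l2 (false , Φ₂b , Φ₃b)

_≐?_ : {n : ℕ} (S T : Subset (Fin n)) → Dec (S ≐ T)
S ≐? T = all? λ x → S x Bool.≟ T x

_≈D?_ : {n : ℕ} (D E : Dividon (Fin n)) → Dec (D ≈D E)
D ≈D? E = (dset D ≐? dset E) ×-dec ( ((δ₁ D ≐? δ₁ E) ×-dec (δ₂ D ≐? δ₂ E))
                                   ⊎-dec ((δ₁ D ≐? δ₂ E) ×-dec (δ₂ D ≐? δ₁ E)))

_∈Θ?_ : {n : ℕ} (D : Dividon (Fin n)) (Es : List (Dividon (Fin n))) → Dec (D ∈Θ Es)
D ∈Θ? Es = map′ find (λ (E , E∈ , D≈E) → lose E∈ D≈E) (Any.any? (D ≈D?_) Es)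

all-Bool? : {Q : Bool → Set} → Decidable Q → Dec (∀ b → Q b)
all-Bool? Q? = map′ (λ { (Qt , Qf) true → Qt ; (Qt , Qf) false → Qf }) (λ ∀Q → ∀Q true , ∀Q false)
                    (Q? true ×-dec Q? false)

all-Vec? : {A : Set} → (∀ {Q : A → Set} → Decidable Q → Dec (∀ a → Q a)) →
           ∀ {n} {Q : Vec A n → Set} → Decidable Q → Dec (∀ xs → Q xs)
all-Vec? all-A? {ℕ.zero}  Q? = map′ (λ { Q[] [] → Q[] }) (λ ∀Q → ∀Q []) (Q? [])
all-Vec? all-A? {ℕ.suc n} Q? =
  map′ (λ ∀Q → λ { (x ∷ xs) → ∀Q x xs }) (λ ∀Q x xs → ∀Q (x ∷ xs))
       (all-A? λ x → all-Vec? all-A? λ xs → Q? (x ∷ xs))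

-- Coordinates: the complete graph on Fin 4

-- The six edges {0,1},{0,2},{0,3},{1,2},{1,3},{2,3}, their endpoints and the
-- two points outside them.
Edge : Set
Edge = Fin 6

endA endB outA outB : Edge → Fin 4
endA = lookup (# 0 ∷ # 0 ∷ # 0 ∷ # 1 ∷ # 1 ∷ # 2 ∷ [])
endB = lookup (# 1 ∷ # 2 ∷ # 3 ∷ # 2 ∷ # 3 ∷ # 3 ∷ [])
outA = lookup (# 2 ∷ # 1 ∷ # 1 ∷ # 0 ∷ # 0 ∷ # 0 ∷ [])
outB = lookup (# 3 ∷ # 3 ∷ # 2 ∷ # 3 ∷ # 2 ∷ # 1 ∷ [])

ends : Edge → Subset (Fin 4)
ends k = ⟦ endA k ∷ endB k ∷ [] ⟧

-- The three edges through a vertex, and the three edges of the triangle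
-- avoiding a vertex.
star triangle : Fin 4 → Fin 3 → Edge
star v = lookup (lookup ( (# 0 ∷ # 1 ∷ # 2 ∷ []) ∷ (# 0 ∷ # 3 ∷ # 4 ∷ [])
                        ∷ (# 1 ∷ # 3 ∷ # 5 ∷ []) ∷ (# 2 ∷ # 4 ∷ # 5 ∷ []) ∷ []) v)
triangle w = lookup (lookup ( (# 3 ∷ # 4 ∷ # 5 ∷ []) ∷ (# 1 ∷ # 2 ∷ # 5 ∷ [])
                            ∷ (# 0 ∷ # 2 ∷ # 4 ∷ []) ∷ (# 0 ∷ # 1 ∷ # 3 ∷ []) ∷ []) w)

edges-∪ edges-∩ : (Fin 3 → Edge) → Subset (Fin 4)
edges-∪ t y = ends (t (# 0)) y ∨ ends (t (# 1)) y ∨ ends (t (# 2)) y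
edges-∩ t y = ends (t (# 0)) y ∧ ends (t (# 1)) y ∧ ends (t (# 2)) y

canon : Edge → Bool → Dividon (Fin 4)
canon k b = div (ends k) (if b then ⟦ outA k ∷ outB k ∷ [] ⟧ else ⟦ outA k ∷ [] ⟧)
                         (if b then ⟦ [] ⟧ else ⟦ outB k ∷ [] ⟧)

ends-injective : ∀ k l → ends k ≐ ends l → k ≡ l
ends-injective = from-yes (all? λ k → all? λ l → (ends k ≐? ends l) →-dec (k ≟ l))

pair-is-edge : ∀ u v → u ≢ v → ∃ λ k → ⟦ u ∷ v ∷ [] ⟧ ≐ ends k
pair-is-edge = from-yes (all? λ u → all? λ v → ¬? (u ≟ v) →-dec any? λ k → ⟦ u ∷ v ∷ [] ⟧ ≐? ends k)

outA≢outB : ∀ k → outA k ≢ outB k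
outA≢outB = from-yes (all? λ k → ¬? (outA k ≟ outB k))

outA∉ : ∀ k → ends k (outA k) ≡ false
outA∉ = from-yes (all? λ k → ends k (outA k) Bool.≟ false)

outB∉ : ∀ k → ends k (outB k) ≡ false
outB∉ = from-yes (all? λ k → ends k (outB k) Bool.≟ false)

ends-outside : ∀ k y → ends k y ≡ false → y ≡ outA k ⊎ y ≡ outB k
ends-outside = from-yes (all? λ k → all? λ y → (ends k y Bool.≟ false) →-dec (y ≟ outA k ⊎-dec y ≟ outB k))

canon-OnPair : ∀ k b → OnPair (canon k b) (outA k) (outB k)
canon-OnPair k b = record
  { cover    = from-yes (all? λ k → all-Bool? λ b → all? λ y →
                 (δ₁ (canon k b) y ∨ δ₂ (canon k b) y) Bool.≟ not (ends k y)) k b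
  ; disjoint = from-yes (all? λ k → all-Bool? λ b → all? λ y →
                 (δ₁ (canon k b) y ∧ δ₂ (canon k b) y) Bool.≟ false) k b
  ; a≢b      = outA≢outB k
  ; a∉       = outA∉ k
  ; b∉       = outB∉ k
  ; outside  = ends-outside k
  }

canon-phi : ∀ k b → phi (canon k b) (outA k) (outB k) ≡ b
canon-phi = from-yes (all? λ k → all-Bool? λ b → phi (canon k b) (outA k) (outB k) Bool.≟ b)

star-∪ : ∀ v y → edges-∪ (star v) y ≡ true
star-∪ = from-yes (all? λ v → all? λ y → edges-∪ (star v) y Bool.≟ true)

star-∩ : ∀ v y → edges-∩ (star v) y ≡ ⟦ v ∷ [] ⟧ y
star-∩ = from-yes (all? λ v → all? λ y → edges-∩ (star v) y Bool.≟ ⟦ v ∷ [] ⟧ y)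

size-two-edge : {S : Subset (Fin 4)} → HasSize S 2 → ∃ λ k → S ≐ ends k
size-two-edge (u ∷ v ∷ [] , (u≢v All.∷ All.[]) ∷ _ , refl , S⇔uv) =
  let (k , uv≐k) = pair-is-edge u v u≢v in k , ≐-trans (enumerated S⇔uv) uv≐k

-- The edge whose endpoints form S (an arbitrary edge if there is none).
edgeOf : Subset (Fin 4) → Edge
edgeOf S with any? (λ k → S ≐? ends k)
... | yes (k , _) = k
... | no  _       = zero

edgeOf-correct : {S : Subset (Fin 4)} {k : Edge} → S ≐ ends k → edgeOf S ≡ k
edgeOf-correct {S} {k} S≐k with any? (λ l → S ≐? ends l)
... | yes (l , S≐l) = ends-injective l k (≐-trans (≐-sym S≐l) S≐k)
... | no  none      = ⊥-elim (none (k , S≐k))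

others : Fin 4 → List (Fin 4)
others w = map (punchIn w) (allFin 3)

others-unique : ∀ w → Unique (others w)
others-unique w = Unique.map⁺ (punchIn-injective w _ _) (Unique.allFin⁺ 3)

triangle-∪ : ∀ w y → edges-∪ (triangle w) y ≡ ⟦ others w ⟧ y
triangle-∪ = from-yes (all? λ w → all? λ y → edges-∪ (triangle w) y Bool.≟ ⟦ others w ⟧ y)

triangle-misses : ∀ w → edges-∪ (triangle w) w ≡ false
triangle-misses = from-yes (all? λ w → edges-∪ (triangle w) w Bool.≟ false)

triangle-distinct : ∀ w (i j : Fin 3) → i ≢ j → triangle w i ≢ triangle w j
triangle-distinct =
  from-yes (all? λ w → all? λ i → all? λ j → ¬? (i ≟ j) →-dec ¬? (triangle w i ≟ triangle w j))

-- Profiles and their classification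

-- φ on the dividon of each edge, for R = P.
Profile : Set
Profile = Edge → Bool

-- Split exactly on the edges through v (Conc₄¹ is the case v = p1).
starProfile : Fin 4 → Profile
starProfile v k = not (ends k v)

-- Split exactly on the perfect matching pairing p1 with suc m (Conv₄: suc m = p3).
matchingProfile : Fin 3 → Profile
matchingProfile m k = ends k (# 0) xor ends k (suc m)

-- Consequence of (L1),(L2): around each vertex, φ₁ = φ₂ xor φ₃.
Parity : Profile → Set
Parity β = ∀ v → β (star v (# 0)) ≡ β (star v (# 1)) xor β (star v (# 2))

-- Consequence of (L3): no triangle has three split edges.
NoSplitTriangle : Profile → Set
NoSplitTriangle β = ∀ w → β (triangle w (# 0)) ≡ false → β (triangle w (# 1)) ≡ false →
                          β (triangle w (# 2)) ≡ true

Classified : Profile → Set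
Classified β = (∃ λ v → ∀ k → β k ≡ starProfile v k) ⊎ (∃ λ m → ∀ k → β k ≡ matchingProfile m k)

classify-table : ∀ (bs : Vec Bool 6) → Parity (lookup bs) → NoSplitTriangle (lookup bs) → Classified (lookup bs)
classify-table = from-yes (all-Vec? all-Bool? λ bs → let β = lookup bs in
  (all? λ v → β (star v (# 0)) Bool.≟ (β (star v (# 1)) xor β (star v (# 2)))) →-dec
  ((all? λ w → (β (triangle w (# 0)) Bool.≟ false) →-dec
               ((β (triangle w (# 1)) Bool.≟ false) →-dec (β (triangle w (# 2)) Bool.≟ true))) →-dec
   ((any? λ v → all? λ k → β k Bool.≟ starProfile v k) ⊎-dec
    (any? λ m → all? λ k → β k Bool.≟ matchingProfile m k))))

classify : (β : Profile) → Parity β → NoSplitTriangle β → Classified β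
classify β parity noSplit = untabulate (classify-table (tabulate β) parity-table noSplit-table)
  where
    table : ∀ k → lookup (tabulate β) k ≡ β k
    table = lookup∘tabulate β
    parity-table : Parity (lookup (tabulate β))
    parity-table v = trans (table _) (trans (parity v) (sym (cong₂ _xor_ (table _) (table _))))
    noSplit-table : NoSplitTriangle (lookup (tabulate β))
    noSplit-table w f₀ f₁ = trans (table _) (noSplit w (trans (sym (table _)) f₀) (trans (sym (table _)) f₁))
    untabulate : Classified (lookup (tabulate β)) → Classified β
    untabulate (inj₁ (v , β≗)) = inj₁ (v , λ k → trans (sym (table k)) (β≗ k))
    untabulate (inj₂ (m , β≗)) = inj₂ (m , λ k → trans (sym (table k)) (β≗ k))

Canon : Profile → RawDPS
Canon β = record { P = Fin 4 ; Θ = map (λ k → canon k (β k)) (allFin 6) }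

canon-∈ : (β : Profile) (k : Edge) → canon k (β k) ∈ Θ (Canon β)
canon-∈ β k = ∈-map⁺ (λ k → canon k (β k)) (∈-allFin k)

Canon-iso : (β : Profile) (Y : RawDPS) (ρ : Fin 4 ↔ P Y) →
            (∀ k → mapDividon ρ (canon k (β k)) ∈Θ Θ Y) → Isomorphic (Canon β) Y
Canon-iso β Y ρ placed = ρ , λ D D∈ →
  let (k , _ , D≡) = ∈-map⁻ (λ k → canon k (β k)) D∈ in
  subst (λ D → mapDividon ρ D ∈Θ Θ Y) (sym D≡) (placed k)

Canon-no-iso : (β : Profile) (Es : List (Dividon (Fin 4))) →
               (∀ (g : Vec (Fin 4) 4) → ¬ (∀ k → pull (lookup g) (canon k (β k)) ∈Θ Es)) →
               ¬ Isomorphic (Canon β) (record { P = Fin 4 ; Θ = Es })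
Canon-no-iso β Es unplaceable (f , maps) = unplaceable (tabulate g) λ k →
  ∈Θ-resp (pull-cong (lookup∘tabulate g) (canon k (β k))) (maps _ (canon-∈ β k))
  where g = Inverse.from f

Canon-cong : {β β′ : Profile} → (∀ k → β k ≡ β′ k) → Isomorphic (Canon β) (Canon β′)
Canon-cong {β} {β′} β≗β′ = Canon-iso β (Canon β′) (↔-id (Fin 4)) λ k →
  canon k (β k) , subst (λ b → canon k b ∈ Θ (Canon β′)) (sym (β≗β′ k)) (canon-∈ β′ k) , ≈D-refl

star-Conc41 : ∀ v → Isomorphic (Canon (starProfile v)) Conc41
star-Conc41 v = Canon-iso (starProfile v) Conc41 (transpose (# 0) v) (placed v)
  where
    placed : ∀ v k → mapDividon (transpose (# 0) v) (canon k (starProfile v k)) ∈Θ Θ Conc41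
    placed = from-yes (all? λ v → all? λ k →
               mapDividon (transpose (# 0) v) (canon k (starProfile v k)) ∈Θ? Θ Conc41)

matching-Conv4 : ∀ m → Isomorphic (Canon (matchingProfile m)) Conv4
matching-Conv4 m = Canon-iso (matchingProfile m) Conv4 (transpose (# 2) (suc m)) (placed m)
  where
    placed : ∀ m k → mapDividon (transpose (# 2) (suc m)) (canon k (matchingProfile m k)) ∈Θ Θ Conv4
    placed = from-yes (all? λ m → all? λ k →
               mapDividon (transpose (# 2) (suc m)) (canon k (matchingProfile m k)) ∈Θ? Θ Conv4)

star-not-Conv4 : ∀ v → ¬ Isomorphic (Canon (starProfile v)) Conv4
star-not-Conv4 v = Canon-no-iso (starProfile v) (Θ Conv4) (unplaceable v)
  where
    unplaceable : ∀ v (g : Vec (Fin 4) 4) → ¬ (∀ k → pull (lookup g) (canon k (starProfile v k)) ∈Θ Θ Conv4)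
    unplaceable = from-yes (all? λ v → all-Vec? all? λ g →
                    ¬? (all? λ k → pull (lookup g) (canon k (starProfile v k)) ∈Θ? Θ Conv4))

matching-not-Conc41 : ∀ m → ¬ Isomorphic (Canon (matchingProfile m)) Conc41
matching-not-Conc41 m = Canon-no-iso (matchingProfile m) (Θ Conc41) (unplaceable m)
  where
    unplaceable : ∀ m (g : Vec (Fin 4) 4) →
                  ¬ (∀ k → pull (lookup g) (canon k (matchingProfile m k)) ∈Θ Θ Conc41)
    unplaceable = from-yes (all? λ m → all-Vec? all? λ g →
                    ¬? (all? λ k → pull (lookup g) (canon k (matchingProfile m k)) ∈Θ? Θ Conc41))

module InCoordinates (X : RawDPS) (e : P X ↔ Fin 4)
                     (isDividon : ∀ D → D ∈ Θ X → IsDividon D)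
                     (firstsDistinct : AllPairs (λ D E → ¬ (dset D ≐ dset E)) (Θ X))
                     (six : length (Θ X) ≡ 6) where

  open Inverse e using (to) renaming (from to pt)

  pt∘to : ∀ x → pt (to x) ≡ x
  pt∘to = Inverse.strictlyInverseʳ e

  to∘pt : ∀ y → to (pt y) ≡ y
  to∘pt = Inverse.strictlyInverseˡ e

  record OnEdge (D : Dividon (P X)) (k : Edge) : Set where
    constructor on-edge
    field dset-edge : ∀ x → dset D x ≡ ends k (to x)
  open OnEdge

  coords : Dividon (P X) → Dividon (Fin 4)
  coords = mapDividon e

  coords-dset : ∀ {D k} → OnEdge D k → dset (coords D) ≐ ends k
  coords-dset {k = k} onEdge y = trans (dset-edge onEdge (pt y)) (cong (ends k) (to∘pt y))

  edge-of : ∀ {D} → D ∈ Θ X → ∃ λ k → OnEdge D k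
  edge-of {D} D∈ =
    let (k , pulled≐k) = size-two-edge (HasSize-pull (↔-sym e) (IsDividon.two (isDividon D D∈))) in
    k , on-edge λ x → trans (cong (dset D) (sym (pt∘to x))) (pulled≐k (to x))

  onPair : ∀ {D k} → D ∈ Θ X → OnEdge D k → OnPair D (pt (outA k)) (pt (outB k))
  onPair {D} {k} D∈ onEdge = record
    { cover    = IsDividon.union (isDividon D D∈)
    ; disjoint = IsDividon.disjoint (isDividon D D∈)
    ; a≢b      = λ eq → outA≢outB k (trans (sym (to∘pt _)) (trans (cong to eq) (to∘pt _)))
    ; a∉       = trans (dset-edge onEdge _) (trans (cong (ends k) (to∘pt _)) (outA∉ k))
    ; b∉       = trans (dset-edge onEdge _) (trans (cong (ends k) (to∘pt _)) (outB∉ k))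
    ; outside  = λ x x∉ → map-⊎ (back x) (back x) (ends-outside k (to x) (trans (sym (dset-edge onEdge x)) x∉))
    }
    where
      back : ∀ x {y} → to x ≡ y → x ≡ pt y
      back x eq = trans (sym (pt∘to x)) (cong pt eq)

  coords-onPair : ∀ {D k} → D ∈ Θ X → OnEdge D k → OnPair (coords D) (outA k) (outB k)
  coords-onPair {D} D∈ onEdge = subst₂ (OnPair (coords D)) (to∘pt _) (to∘pt _) (OnPair-map e (onPair D∈ onEdge))

  -- Every edge carries a dividon of X, since the six dividons lie on distinct
  -- edges (`code` reads off the edge of a dividon).
  code : Dividon (P X) → Edge
  code D = edgeOf (dset (coords D))

  onEdge-code : ∀ {D} → D ∈ Θ X → OnEdge D (code D)
  onEdge-code {D} D∈ =
    let (k , onEdge) = edge-of D∈ in subst (OnEdge D) (sym (edgeOf-correct (coords-dset onEdge))) onEdge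

  codes-unique : Unique (map code (Θ X))
  codes-unique = AllPairs.map⁺ (AllPairs-weaken distinct-codes firstsDistinct)
    where
      distinct-codes : ∀ {D E} → D ∈ Θ X → E ∈ Θ X → ¬ (dset D ≐ dset E) → code D ≢ code E
      distinct-codes D∈ E∈ different same-code = different λ x →
        trans (dset-edge (onEdge-code D∈) x)
              (trans (cong (λ k → ends k (to x)) same-code) (sym (dset-edge (onEdge-code E∈) x)))

  edge-dividon : ∀ k → ∃ λ D → D ∈ Θ X × OnEdge D k
  edge-dividon k =
    let (D , D∈ , k≡) = ∈-map⁻ code (unique-covers _ codes-unique (trans (length-map code (Θ X)) six) k) in
    D , D∈ , subst (OnEdge D) (sym k≡) (onEdge-code D∈)

  dividonOn : Edge → Dividon (P X)
  dividonOn k = proj₁ (edge-dividon k)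

  dividonOn-∈ : ∀ k → dividonOn k ∈ Θ X
  dividonOn-∈ k = proj₁ (proj₂ (edge-dividon k))

  dividonOn-onEdge : ∀ k → OnEdge (dividonOn k) k
  dividonOn-onEdge k = proj₂ (proj₂ (edge-dividon k))

  edge-unique : ∀ {D E k} → D ∈ Θ X → E ∈ Θ X → OnEdge D k → OnEdge E k → D ≡ E
  edge-unique {D} {E} D∈ E∈ onD onE =
    AllPairs-same firstsDistinct D∈ E∈ (λ ne → ne same) (λ ne → ne (≐-sym same))
    where
      same : dset D ≐ dset E
      same x = trans (dset-edge onD x) (sym (dset-edge onE x))

  profile : Profile
  profile k = phi (dividonOn k) (pt (outA k)) (pt (outB k))

  phi-profile : ∀ {D k} → D ∈ Θ X → OnEdge D k → phi D (pt (outA k)) (pt (outB k)) ≡ profile k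
  phi-profile {k = k} D∈ onEdge =
    cong (λ E → phi E _ _) (edge-unique D∈ (dividonOn-∈ k) onEdge (dividonOn-onEdge k))

  coords≈canon : ∀ {D k} → D ∈ Θ X → OnEdge D k → coords D ≈D canon k (profile k)
  coords≈canon {k = k} D∈ onEdge =
    determined (coords-onPair D∈ onEdge) (canon-OnPair k (profile k)) (coords-dset onEdge)
               (trans (phi-profile D∈ onEdge) (sym (canon-phi k (profile k))))

  canon≈coords : ∀ {D k} → D ∈ Θ X → OnEdge D k → canon k (profile k) ≈D coords D
  canon≈coords {k = k} D∈ onEdge =
    determined (canon-OnPair k (profile k)) (coords-onPair D∈ onEdge) (≐-sym (coords-dset onEdge))
               (trans (canon-phi k (profile k)) (sym (phi-profile D∈ onEdge)))

  X≅Canon : Isomorphic X (Canon profile)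
  X≅Canon = e , λ D D∈ →
    let (k , onEdge) = edge-of D∈ in canon k (profile k) , canon-∈ profile k , coords≈canon D∈ onEdge

  Canon≅X : Isomorphic (Canon profile) X
  Canon≅X = Canon-iso profile X (↔-sym e) λ k →
    let (D , D∈ , onEdge) = edge-dividon k in
    D , D∈ , ≈D-trans (pull-resp to (canon≈coords D∈ onEdge)) (pull-cong {h = id} pt∘to D)

  Φ-profile : ∀ {D k} → D ∈ Θ X → OnEdge D k → φ≡ full D (profile k)
  Φ-profile D∈ onEdge = subst (φ≡ full _) (phi-profile D∈ onEdge) (Φ-phi (onPair D∈ onEdge))

  profile-forced : ∀ {D k c} → D ∈ Θ X → OnEdge D k → φ≡ full D c → c ≡ profile k
  profile-forced D∈ onEdge Φc = trans (Φ-determines (onPair D∈ onEdge) Φc) (phi-profile D∈ onEdge)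

  full-size : HasSize (full {P X}) 4
  full-size = HasSize-pull e (allFin 4 , Unique.allFin⁺ 4 , refl , λ y → mk⇔ (λ _ → ∈-allFin y) (λ _ → refl))

  module Triple (t : Fin 3 → Edge) where
    D : Fin 3 → Dividon (P X)
    D i = dividonOn (t i)

    member : ∀ i → D i ∈ Θ X
    member i = dividonOn-∈ (t i)

    on : ∀ i x → dset (D i) x ≡ ends (t i) (to x)
    on i = dset-edge (dividonOn-onEdge (t i))

    ∪-coords : ∀ x → union3 (D (# 0)) (D (# 1)) (D (# 2)) x ≡ edges-∪ t (to x)
    ∪-coords x = cong₂ _∨_ (on (# 0) x) (cong₂ _∨_ (on (# 1) x) (on (# 2) x))

    ∩-coords : ∀ x → inter3 (D (# 0)) (D (# 1)) (D (# 2)) x ≡ edges-∩ t (to x)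
    ∩-coords x = cong₂ _∧_ (on (# 0) x) (cong₂ _∧_ (on (# 1) x) (on (# 2) x))

    Φ-at : ∀ i → φ≡ full (D i) (profile (t i))
    Φ-at i = Φ-profile (member i) (dividonOn-onEdge (t i))

    forced : ∀ i {c} → φ≡ full (D i) c → c ≡ profile (t i)
    forced i = profile-forced (member i) (dividonOn-onEdge (t i))

  -- (L1) and (L2) at the star of v, where the hypothesis holds with R = P.
  parity : Law1 X → Law2 X → Parity profile
  parity law1 law2 v =
    sym (forced (# 0) (law-xor {φ≡ full (D (# 0))} {φ≡ full (D (# 1))} {φ≡ full (D (# 2))}
                               (law1 full full-size _ _ _ (member _) (member _) (member _) star-hyp)
                               (law2 full full-size _ _ _ (member _) (member _) (member _) star-hyp)
                               (Φ-at (# 1)) (Φ-at (# 2))))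
    where
      open Triple (star v)
      star-hyp : L12-hyp full (D (# 0)) (D (# 1)) (D (# 2))
      star-hyp = (λ x → trans (∪-coords x) (star-∪ v (to x)))
               , HasSize-≐ (λ x → trans (sym (star-∩ v (to x))) (sym (∩-coords x)))
                           (HasSize-pull e (HasSize-⟦⟧ (v ∷ []) (All.[] ∷ [])))

  -- (L3) at the triangle avoiding w, a proper 3-element part of R = P.
  noSplitTriangle : Law3 X → NoSplitTriangle profile
  noSplitTriangle law3 w split₀ split₁ =
    sym (forced (# 2) (law3 full full-size _ _ _ (member _) (member _) (member _)
                            (apart (# 0) (# 1) (λ ())) (apart (# 0) (# 2) (λ ())) (apart (# 1) (# 2) (λ ()))
                            proper spans
                            (subst (φ≡ full _) split₀ (Φ-at (# 0))) (subst (φ≡ full _) split₁ (Φ-at (# 1)))))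
    where
      open Triple (triangle w)
      apart : ∀ i j → i ≢ j → ¬ (D i ≈D D j)
      apart i j i≢j (same-dset , _) = triangle-distinct w i j i≢j (ends-injective _ _ λ y →
        trans (sym (coords-dset (dividonOn-onEdge _) y)) (trans (same-dset (pt y)) (coords-dset (dividonOn-onEdge _) y)))
      proper : union3 (D (# 0)) (D (# 1)) (D (# 2)) ⊂ full
      proper = (λ _ _ → refl) , λ everything → true≢false
        (trans (sym (everything (pt w)))
               (trans (∪-coords (pt w)) (trans (cong (edges-∪ (triangle w)) (to∘pt w)) (triangle-misses w))))
      spans : HasSize (union3 (D (# 0)) (D (# 1)) (D (# 2))) 3
      spans = HasSize-≐ (λ x → trans (sym (triangle-∪ w (to x))) (sym (∪-coords x)))
                        (HasSize-pull e (HasSize-⟦⟧ (others w) (others-unique w)))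

  from-Canon : ∀ {β Y} → (∀ k → β k ≡ profile k) → Isomorphic (Canon β) Y → Isomorphic X Y
  from-Canon β≗ iso = Isomorphic-trans X≅Canon (Isomorphic-trans (Canon-cong (sym ∘ β≗)) iso)

  to-Canon : ∀ {β Y} → (∀ k → β k ≡ profile k) → Isomorphic X Y → Isomorphic (Canon β) Y
  to-Canon β≗ iso = Isomorphic-trans (Canon-cong β≗) (Isomorphic-trans Canon≅X iso)

  outcome : Classified profile → (¬ Isomorphic X Conc41) ⇔ Isomorphic X Conv4
  outcome (inj₁ (v , isStar)) =
    mk⇔ (λ notConc → ⊥-elim (notConc (from-Canon (sym ∘ isStar) (star-Conc41 v))))
        (λ conv _ → star-not-Conv4 v (to-Canon (sym ∘ isStar) conv))
  outcome (inj₂ (m , isMatching)) =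
    mk⇔ (λ _ → from-Canon (sym ∘ isMatching) (matching-Conv4 m))
        (λ _ conc → matching-not-Conc41 m (to-Canon (sym ∘ isMatching) conc))

theorem1 : (X : RawDPS) (isX : IsDivPointSet X) →
    IsDivPointSet.size isX ≡ 4 →
    Law1 X → Law2 X → Law3 X →
    (¬ Isomorphic X Conc41) ⇔ Isomorphic X Conv4
theorem1 X isX size≡4 law1 law2 law3 = outcome (classify profile (parity law1 law2) (noSplitTriangle law3))
  where
    open IsDivPointSet isX
    open InCoordinates X (subst (λ n → P X ↔ Fin n) size≡4 enum) dividons firstsDistinct
                         (trans card (cong (_C 2) size≡4))
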